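{- Let $A,K$ be integers with either ($A\ge 3$ and ($K=3$ or $K\ge 5$)) or ($A=2$ and $K\ge 6$). Put $a=K$, $b=A^2K-4A$, $c=(A+1)^2K-4(A+1)$, $r=AK-2$, $s=(A+1)K-2$, and \[ \alpha=\frac{s+\sqrt{ac}}{2},\qquad \beta=\frac{r+\sqrt{ab}}{2}. \] Then $\alpha-\beta>K=s-r$.
   Context: Note that $ab+4=r^2$ and $ac+4=s^2$. -}

module Defs where

open import Data.Integer as ℤ using (ℤ; +_)
open import Data.Rational as ℚ using (ℚ; 0ℚ; _/_)
open import Data.Sum using (_⊎_)
open import Data.Product using (_×_)

ι : ℤ → ℚ
ι z = z / 1

-- For an integer n ≥ 0 and a rational x, "√n < x" (Dedekind-cut definition
-- of the real square root): x ≥ 0 and n < x².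
SqrtLt : ℤ → ℚ → Set
SqrtLt n x = (0ℚ ℚ.≤ x) × (ι n ℚ.< x ℚ.* x)

-- "x < √n": x < 0 or x² < n.
LtSqrt : ℚ → ℤ → Set
LtSqrt x n = (x ℚ.< 0ℚ) ⊎ (x ℚ.* x ℚ.< ι n)

module _ (A K : ℤ) where
  a b c r s : ℤ
  a = K
  b = A ℤ.* A ℤ.* K ℤ.- + 4 ℤ.* A
  c = (A ℤ.+ + 1) ℤ.* (A ℤ.+ + 1) ℤ.* K ℤ.- + 4 ℤ.* (A ℤ.+ + 1)
  r = A ℤ.* K ℤ.- + 2
  s = (A ℤ.+ + 1) ℤ.* K ℤ.- + 2

Hyp : ℤ → ℤ → Set
Hyp A K = ((+ 3 ℤ.≤ A) × (K ≡ + 3 ⊎ + 5 ℤ.≤ K)) ⊎ (A ≡ + 2 × + 6 ℤ.≤ K)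
  where open import Relation.Binary.PropositionalEquality using (_≡_)

-- α - β > K for α = (s + √(ac))/2, β = (r + √(ab))/2, expressed as:
-- there are rationals p, q with √(ab) < p and q < √(ac) such that
-- (s + q)/2 - (r + p)/2 > K.  (A strict real inequality holds iff such
-- rational separators exist.)
AlphaMinusBetaGtK : ℤ → ℤ → Set
AlphaMinusBetaGtK A K =
  Σ ℚ λ p → Σ ℚ λ q →
    SqrtLt (a A K ℤ.* b A K) p × LtSqrt q (a A K ℤ.* c A K) ×
    (ι K ℚ.< ((ι (s A K) ℚ.+ q) ℚ.* ℚ.½) ℚ.- ((ι (r A K) ℚ.+ p) ℚ.* ℚ.½))
  where open import Data.Product using (Σ)

-- Since ab = r² − 4 and ac = s² − 4 with s − r = K, the claim reads
-- √(s² − 4) − √(r² − 4) > s − r.  Truncating √(x² − 4) = x − 2/x − 2/x³ − …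
-- gives the rationals p = r − 2/r > √(r² − 4) and q = s − 2/s − 4/s³ < √(s² − 4),
-- and these already separate: q − p − (s − r) = 2(s²(s − r) − 2r)/(rs³) > 0.
-- Each rational inequality is cleared of denominators; the resulting integer
-- inequality is a ring identity exhibiting the difference as 1 plus a
-- polynomial with natural coefficients in the nonnegative numbers r − 2 and
-- s − r − 1.
module Submission where

open import Data.Nat as ℕ using (ℕ; suc; s≤s; z≤n)
import Data.Nat.Properties as ℕ
open import Data.Integer using (ℤ; +_; +<+; +≤+; 0ℤ; 1ℤ; _+_; _*_; _-_; -_; _<_; _≤_)
import Data.Integer.Properties as ℤ
open import Data.Integer.Tactic.RingSolver using (solve-∀)
open import Algebra.Properties.CommutativeSemigroup ℤ.*-commutativeSemigroup
  using (interchange; xy∙z≈xz∙y)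
open import Data.Rational as ℚ using (ℚ; 0ℚ; toℚᵘ; ½)
import Data.Rational.Properties as ℚ
open import Data.Rational.Unnormalised as ℚᵘ using (ℚᵘ; mkℚᵘ; ↥_; ↧_; *≡*; *<*)
open import Data.Product using (Σ; _×_; _,_; proj₁; proj₂)
open import Data.Sum using (inj₁; inj₂)
open import Relation.Binary.PropositionalEquality
open ≡-Reasoning

open import Defs

*-pos : ∀ {i j} → 0ℤ < i → 0ℤ < j → 0ℤ < i * j
*-pos (+<+ {n = suc _} _) (+<+ {n = suc _} _) = +<+ (s≤s z≤n)

*-nonNeg : ∀ {i j} → 0ℤ ≤ i → 0ℤ ≤ j → 0ℤ ≤ i * j
*-nonNeg (+≤+ {n = m} _) (+≤+ {n = n} _) = subst (0ℤ ≤_) (ℤ.pos-* m n) (+≤+ z≤n)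

≤-by-gap : ∀ {i j} e → j ≡ i + e → 0ℤ ≤ e → i ≤ j
≤-by-gap {i} e refl 0≤e = subst (_≤ i + e) (ℤ.+-identityʳ i) (ℤ.+-monoʳ-≤ i 0≤e)

<-by-gap : ∀ {i j} e → j ≡ i + (1ℤ + e) → 0ℤ ≤ e → i < j
<-by-gap {i} e refl (+≤+ _) =
  subst (_< i + (1ℤ + e)) (ℤ.+-identityʳ i) (ℤ.+-monoʳ-< i (+<+ (s≤s z≤n)))

infixl 6 _⊕_
infixl 7 _⊗_

data Poly : Set where
  con : ℕ → Poly
  X Y : Poly
  _⊕_ _⊗_ : Poly → Poly → Poly

⟦_⟧ : Poly → ℤ → ℤ → ℤ
⟦ con n ⟧ x y = + n
⟦ X ⟧     x y = x
⟦ Y ⟧     x y = y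
⟦ e ⊕ f ⟧ x y = ⟦ e ⟧ x y + ⟦ f ⟧ x y
⟦ e ⊗ f ⟧ x y = ⟦ e ⟧ x y * ⟦ f ⟧ x y

⟦⟧-nonNeg : ∀ e {x y} → 0ℤ ≤ x → 0ℤ ≤ y → 0ℤ ≤ ⟦ e ⟧ x y
⟦⟧-nonNeg (con n) _   _   = +≤+ z≤n
⟦⟧-nonNeg X       0≤x _   = 0≤x
⟦⟧-nonNeg Y       _   0≤y = 0≤y
⟦⟧-nonNeg (e ⊕ f) 0≤x 0≤y = ℤ.+-mono-≤ (⟦⟧-nonNeg e 0≤x 0≤y) (⟦⟧-nonNeg f 0≤x 0≤y)
⟦⟧-nonNeg (e ⊗ f) 0≤x 0≤y = *-nonNeg (⟦⟧-nonNeg e 0≤x 0≤y) (⟦⟧-nonNeg f 0≤x 0≤y)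

module Unnormalised where

  infix 4 _≃_÷_

  record _≃_÷_ (u : ℚᵘ) (n d : ℤ) : Set where
    constructor fraction
    field
      denominator-pos : 0ℤ < d
      cross : ↥ u * d ≡ n * ↧ u

  open _≃_÷_

  ÷-resp-≃ : ∀ {u v n d} → u ℚᵘ.≃ v → v ≃ n ÷ d → u ≃ n ÷ d
  ÷-resp-≃ {u} {v} {n} {d} (*≡* u≃v) (fraction 0<d v≃) =
    fraction 0<d (ℤ.*-cancelʳ-≡ _ _ (↧ v) (begin
      ↥ u * d * ↧ v ≡⟨ xy∙z≈xz∙y (↥ u) d (↧ v) ⟩
      ↥ u * ↧ v * d ≡⟨ cong (_* d) u≃v ⟩
      ↥ v * ↧ u * d ≡⟨ xy∙z≈xz∙y (↥ v) (↧ u) d ⟩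
      ↥ v * d * ↧ u ≡⟨ cong (_* ↧ u) v≃ ⟩
      n * ↧ v * ↧ u ≡⟨ xy∙z≈xz∙y n (↧ v) (↧ u) ⟩
      n * ↧ u * ↧ v ∎))

  cross-scaled : ∀ {u n d} → u ≃ n ÷ d → ∀ x y → (↥ u * x) * (d * y) ≡ (n * y) * (↧ u * x)
  cross-scaled {u} {n} {d} (fraction _ u≃) x y = begin
    (↥ u * x) * (d * y) ≡⟨ interchange (↥ u) x d y ⟩
    (↥ u * d) * (x * y) ≡⟨ cong (_* (x * y)) u≃ ⟩
    (n * ↧ u) * (x * y) ≡⟨ regroup n (↧ u) x y ⟩
    (n * y) * (↧ u * x) ∎
    where
    regroup : ∀ a b c e → (a * b) * (c * e) ≡ (a * e) * (b * c)
    regroup = solve-∀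

  cross-terms : ∀ {u v a b c d} → u ≃ a ÷ b → v ≃ c ÷ d →
    (↥ u * ↧ v) * (b * d) ≡ (a * d) * (↧ u * ↧ v) ×
    (↥ v * ↧ u) * (b * d) ≡ (c * b) * (↧ u * ↧ v)
  cross-terms {u} {v} {a} {b} {c} {d} u≃ v≃ = cross-scaled u≃ (↧ v) d , (begin
    (↥ v * ↧ u) * (b * d) ≡⟨ cong ((↥ v * ↧ u) *_) (ℤ.*-comm b d) ⟩
    (↥ v * ↧ u) * (d * b) ≡⟨ cross-scaled v≃ (↧ u) b ⟩
    (c * b) * (↧ v * ↧ u) ≡⟨ cong ((c * b) *_) (ℤ.*-comm (↧ v) (↧ u)) ⟩
    (c * b) * (↧ u * ↧ v) ∎)

  +-÷ : ∀ {u v a b c d} → u ≃ a ÷ b → v ≃ c ÷ d → u ℚᵘ.+ v ≃ (a * d + c * b) ÷ (b * d)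
  +-÷ {u@(mkℚᵘ _ _)} {v@(mkℚᵘ _ _)} {a} {b} {c} {d} u≃ v≃ =
    fraction (*-pos (denominator-pos u≃) (denominator-pos v≃)) (begin
      (↥ u * ↧ v + ↥ v * ↧ u) * (b * d)
        ≡⟨ ℤ.*-distribʳ-+ (b * d) (↥ u * ↧ v) (↥ v * ↧ u) ⟩
      (↥ u * ↧ v) * (b * d) + (↥ v * ↧ u) * (b * d)
        ≡⟨ cong₂ _+_ (proj₁ (cross-terms u≃ v≃)) (proj₂ (cross-terms u≃ v≃)) ⟩
      (a * d) * (↧ u * ↧ v) + (c * b) * (↧ u * ↧ v)
        ≡⟨ ℤ.*-distribʳ-+ (↧ u * ↧ v) (a * d) (c * b) ⟨
      (a * d + c * b) * ↧ (u ℚᵘ.+ v) ∎)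

  *-÷ : ∀ {u v a b c d} → u ≃ a ÷ b → v ≃ c ÷ d → u ℚᵘ.* v ≃ (a * c) ÷ (b * d)
  *-÷ {u@(mkℚᵘ _ _)} {v@(mkℚᵘ _ _)} {a} {b} {c} {d} (fraction 0<b u≃) (fraction 0<d v≃) =
    fraction (*-pos 0<b 0<d) (begin
      (↥ u * ↥ v) * (b * d) ≡⟨ interchange (↥ u) (↥ v) b d ⟩
      (↥ u * b) * (↥ v * d) ≡⟨ cong₂ _*_ u≃ v≃ ⟩
      (a * ↧ u) * (c * ↧ v) ≡⟨ interchange a (↧ u) c (↧ v) ⟩
      (a * c) * ↧ (u ℚᵘ.* v) ∎)

  -‿÷ : ∀ {u n d} → u ≃ n ÷ d → ℚᵘ.- u ≃ - n ÷ d
  -‿÷ {u@(mkℚᵘ _ _)} {n} {d} (fraction 0<d u≃) = fraction 0<d (begin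
    - ↥ u * d   ≡⟨ ℤ.neg-distribˡ-* (↥ u) d ⟨
    - (↥ u * d) ≡⟨ cong -_ u≃ ⟩
    - (n * ↧ u) ≡⟨ ℤ.neg-distribˡ-* n (↧ u) ⟩
    - n * ↧ u   ∎)

  ÷-< : ∀ {u v a b c d} → u ≃ a ÷ b → v ≃ c ÷ d → a * d < c * b → u ℚᵘ.< v
  ÷-< {u@(mkℚᵘ _ _)} {v@(mkℚᵘ _ _)}
      u≃@(fraction (+<+ {n = suc _} _) _) v≃@(fraction (+<+ {n = suc _} _) _) ad<cb =
    *<* (ℤ.*-cancelʳ-<-nonNeg _
      (subst₂ _<_ (sym (proj₁ (cross-terms u≃ v≃))) (sym (proj₂ (cross-terms u≃ v≃)))
        (ℤ.*-monoʳ-<-pos (↧ u * ↧ v) ad<cb)))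

infix 4 _≐_÷_

_≐_÷_ : ℚ → ℤ → ℤ → Set
x ≐ n ÷ d = toℚᵘ x Unnormalised.≃ n ÷ d

module _ {x y : ℚ} {a b c d : ℤ} where

  +-÷ : x ≐ a ÷ b → y ≐ c ÷ d → x ℚ.+ y ≐ (a * d + c * b) ÷ (b * d)
  +-÷ x≐ y≐ = Unnormalised.÷-resp-≃ (ℚ.toℚᵘ-homo-+ x y) (Unnormalised.+-÷ x≐ y≐)

  *-÷ : x ≐ a ÷ b → y ≐ c ÷ d → x ℚ.* y ≐ (a * c) ÷ (b * d)
  *-÷ x≐ y≐ = Unnormalised.÷-resp-≃ (ℚ.toℚᵘ-homo-* x y) (Unnormalised.*-÷ x≐ y≐)

  ÷-< : x ≐ a ÷ b → y ≐ c ÷ d → a * d < c * b → x ℚ.< y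
  ÷-< x≐ y≐ ad<cb = ℚ.toℚᵘ-cancel-< (Unnormalised.÷-< x≐ y≐ ad<cb)

-‿÷ : ∀ {x n d} → x ≐ n ÷ d → ℚ.- x ≐ - n ÷ d
-‿÷ {x} x≐ = Unnormalised.÷-resp-≃ (ℚ.toℚᵘ-homo‿- x) (Unnormalised.-‿÷ x≐)

/-÷ : ∀ n d .{{_ : ℕ.NonZero d}} → n ℚ./ d ≐ n ÷ + d
/-÷ n (suc d) =
  Unnormalised.÷-resp-≃ (ℚ.toℚᵘ-fromℚᵘ (mkℚᵘ n d)) (Unnormalised.fraction (+<+ (s≤s z≤n)) refl)

ι-÷ : ∀ n → ι n ≐ n ÷ 1ℤ
ι-÷ n = /-÷ n 1

0ℚ-÷ : 0ℚ ≐ 0ℤ ÷ 1ℤ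
0ℚ-÷ = ι-÷ 0ℤ

½-÷ : ½ ≐ + 1 ÷ + 2
½-÷ = /-÷ (+ 1) 2

√⁺ : (r : ℕ) .{{_ : ℕ.NonZero r}} → ℚ
√⁺ r = (+ r * + r - + 2) ℚ./ r

√⁻ : (s : ℕ) .{{_ : ℕ.NonZero s}} → ℚ
√⁻ s = (+ s * + s * (+ s * + s) - + 2 * (+ s * + s) - + 4) ℚ./ (s ℕ.* s ℕ.* s)
  where
  instance
    s³≢0 : ℕ.NonZero (s ℕ.* s ℕ.* s)
    s³≢0 = ℕ.m*n≢0 (s ℕ.* s) s {{ℕ.m*n≢0 s s}}

√⁺-÷ : ∀ r .{{_ : ℕ.NonZero r}} → √⁺ r ≐ + r * + r - + 2 ÷ + r
√⁺-÷ r = /-÷ (+ r * + r - + 2) r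

√⁻-÷ : ∀ s .{{_ : ℕ.NonZero s}} →
  √⁻ s ≐ + s * + s * (+ s * + s) - + 2 * (+ s * + s) - + 4 ÷ + s * + s * + s
√⁻-÷ s = subst (√⁻ s ≐ + s * + s * (+ s * + s) - + 2 * (+ s * + s) - + 4 ÷_) s³-cast
  (/-÷ (+ s * + s * (+ s * + s) - + 2 * (+ s * + s) - + 4) (s ℕ.* s ℕ.* s)
    {{ℕ.m*n≢0 (s ℕ.* s) s {{ℕ.m*n≢0 s s}}}})
  where
  s³-cast : + (s ℕ.* s ℕ.* s) ≡ + s * + s * + s
  s³-cast = trans (ℤ.pos-* (s ℕ.* s) s) (cong (_* + s) (ℤ.pos-* s s))

√⁺-numerator-gap : ∀ r →
  (r * r - + 2) * 1ℤ ≡ 0ℤ * r + (1ℤ + (+ 1 + (r - + 2) * (+ 4 + (r - + 2))))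
√⁺-numerator-gap = solve-∀

√⁺-square-gap : ∀ r →
  ((r * r - + 2) * (r * r - + 2)) * 1ℤ ≡ (r * r - + 4) * (r * r) + (1ℤ + + 3)
√⁺-square-gap = solve-∀

√⁺-above : ∀ r .{{_ : ℕ.NonZero r}} → 2 ℕ.≤ r → SqrtLt (+ r * + r - + 4) (√⁺ r)
√⁺-above r 2≤r =
  ℚ.<⇒≤ (÷-< 0ℚ-÷ (√⁺-÷ r) numerator-pos) ,
  ÷-< (ι-÷ (+ r * + r - + 4)) (*-÷ (√⁺-÷ r) (√⁺-÷ r)) square
  where
  0≤r-2 : 0ℤ ≤ + r - + 2
  0≤r-2 = ℤ.i≤j⇒0≤j-i (+≤+ 2≤r)
  numerator-pos : 0ℤ * + r < (+ r * + r - + 2) * 1ℤ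
  numerator-pos = <-by-gap _ (√⁺-numerator-gap (+ r))
    (⟦⟧-nonNeg (con 1 ⊕ X ⊗ (con 4 ⊕ X)) 0≤r-2 0≤r-2)
  square : (+ r * + r - + 4) * (+ r * + r) < ((+ r * + r - + 2) * (+ r * + r - + 2)) * 1ℤ
  square = <-by-gap (+ 3) (√⁺-square-gap (+ r)) (+≤+ z≤n)

√⁻-square-gap : ∀ s →
  let t = (s - + 3) * (+ 6 + (s - + 3)) ; q = s * s * (s * s) - + 2 * (s * s) - + 4 in
  (s * s - + 4) * (s * s * s * (s * s * s)) ≡ (q * q) * 1ℤ + (1ℤ + (+ 163 + + 56 * t + + 4 * t * t))
√⁻-square-gap = solve-∀

√⁻-below : ∀ s .{{_ : ℕ.NonZero s}} → 3 ℕ.≤ s → LtSqrt (√⁻ s) (+ s * + s - + 4)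
√⁻-below s 3≤s = inj₂ (÷-< (*-÷ (√⁻-÷ s) (√⁻-÷ s)) (ι-÷ (+ s * + s - + 4)) square)
  where
  0≤s-3 : 0ℤ ≤ + s - + 3
  0≤s-3 = ℤ.i≤j⇒0≤j-i (+≤+ 3≤s)
  q : ℤ
  q = + s * + s * (+ s * + s) - + 2 * (+ s * + s) - + 4
  t : Poly
  t = X ⊗ (con 6 ⊕ X)
  square : (q * q) * 1ℤ < (+ s * + s - + 4) * (+ s * + s * + s * (+ s * + s * + s))
  square = <-by-gap _ (√⁻-square-gap (+ s))
    (⟦⟧-nonNeg (con 163 ⊕ con 56 ⊗ t ⊕ con 4 ⊗ t ⊗ t) 0≤s-3 0≤s-3)

separation-gap : ∀ r s →
  let p = r * r - + 2 ; q = s * s * (s * s) - + 2 * (s * s) - + 4 ; c = s * s * s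
      α = (s * c + q * 1ℤ) * + 1 ; dα = 1ℤ * c * + 2
      β = (r * r + p * 1ℤ) * + 1 ; dβ = 1ℤ * r * + 2
      x = r - + 2 ; y = s - (1ℤ + r) ; σ = + 3 + x + y in
  (α * dβ + - β * dα) * 1ℤ ≡ (s - r) * (dα * dβ)
    + (1ℤ + (+ 19 + + 16 * x + + 24 * y + + 4 * (x + y) * (x + y) + + 4 * σ * σ * y))
separation-gap = solve-∀

separation : ∀ r s .{{_ : ℕ.NonZero r}} .{{_ : ℕ.NonZero s}} → 2 ℕ.≤ r → r ℕ.< s →
  ι (+ s - + r) ℚ.< ((ι (+ s) ℚ.+ √⁻ s) ℚ.* ½) ℚ.- ((ι (+ r) ℚ.+ √⁺ r) ℚ.* ½)
separation r s 2≤r r<s = ÷-< (ι-÷ (+ s - + r))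
  (+-÷ (*-÷ (+-÷ (ι-÷ (+ s)) (√⁻-÷ s)) ½-÷) (-‿÷ (*-÷ (+-÷ (ι-÷ (+ r)) (√⁺-÷ r)) ½-÷)))
  (<-by-gap _ (separation-gap (+ r) (+ s)) (⟦⟧-nonNeg gap 0≤r-2 0≤s-r-1))
  where
  0≤r-2 : 0ℤ ≤ + r - + 2
  0≤r-2 = ℤ.i≤j⇒0≤j-i (+≤+ 2≤r)
  0≤s-r-1 : 0ℤ ≤ + s - (1ℤ + + r)
  0≤s-r-1 = ℤ.i≤j⇒0≤j-i (+≤+ r<s)
  σ gap : Poly
  σ = con 3 ⊕ X ⊕ Y
  gap = con 19 ⊕ con 16 ⊗ X ⊕ con 24 ⊗ Y ⊕ con 4 ⊗ (X ⊕ Y) ⊗ (X ⊕ Y) ⊕ con 4 ⊗ σ ⊗ σ ⊗ Y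

√[x²-4]-gap : ∀ {r s} → + 2 ≤ r → r < s →
  Σ ℚ λ p → Σ ℚ λ q → SqrtLt (r * r - + 4) p × LtSqrt q (s * s - + 4) ×
    ι (s - r) ℚ.< ((ι s ℚ.+ q) ℚ.* ½) ℚ.- ((ι r ℚ.+ p) ℚ.* ½)
√[x²-4]-gap (+≤+ {n = r} 2≤r) (+<+ {n = s} r<s) =
  √⁺ r , √⁻ s , √⁺-above r 2≤r , √⁻-below s 3≤s , separation r s 2≤r r<s
  where
  3≤s : 3 ℕ.≤ s
  3≤s = ℕ.≤-trans (s≤s 2≤r) r<s
  instance
    r≢0 : ℕ.NonZero r
    r≢0 = ℕ.>-nonZero (ℕ.<-≤-trans (s≤s z≤n) 2≤r)
    s≢0 : ℕ.NonZero s
    s≢0 = ℕ.>-nonZero (ℕ.<-≤-trans (s≤s z≤n) 3≤s)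

Hyp⇒bounds : ∀ {A K} → Hyp A K → + 2 ≤ A × + 3 ≤ K
Hyp⇒bounds (inj₁ (3≤A , inj₁ refl)) = ℤ.≤-trans (+≤+ (ℕ.n≤1+n 2)) 3≤A , ℤ.≤-refl
Hyp⇒bounds (inj₁ (3≤A , inj₂ 5≤K))  =
  ℤ.≤-trans (+≤+ (ℕ.n≤1+n 2)) 3≤A , ℤ.≤-trans (+≤+ (ℕ.m≤m+n 3 2)) 5≤K
Hyp⇒bounds (inj₂ (refl , 6≤K))      = ℤ.≤-refl , ℤ.≤-trans (+≤+ (ℕ.m≤m+n 3 3)) 6≤K

r-gap : ∀ A K → let x = A - + 2 ; y = K - + 3 in
  A * K - + 2 ≡ + 2 + (+ 2 + + 3 * x + + 2 * y + x * y)
r-gap = solve-∀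

s-gap : ∀ A K → (A + 1ℤ) * K - + 2 ≡ A * K - + 2 + (1ℤ + (+ 2 + (K - + 3)))
s-gap = solve-∀

Hyp⇒2≤r<s : ∀ {A K} → Hyp A K → + 2 ≤ r A K × r A K < s A K
Hyp⇒2≤r<s {A} {K} hyp =
  ≤-by-gap _ (r-gap A K) (⟦⟧-nonNeg (con 2 ⊕ con 3 ⊗ X ⊕ con 2 ⊗ Y ⊕ X ⊗ Y) 0≤A-2 0≤K-3) ,
  <-by-gap _ (s-gap A K) (⟦⟧-nonNeg (con 2 ⊕ Y) 0≤A-2 0≤K-3)
  where
  0≤A-2 : 0ℤ ≤ A - + 2
  0≤A-2 = ℤ.i≤j⇒0≤j-i (proj₁ (Hyp⇒bounds hyp))
  0≤K-3 : 0ℤ ≤ K - + 3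
  0≤K-3 = ℤ.i≤j⇒0≤j-i (proj₂ (Hyp⇒bounds hyp))

ab≡r²-4 : ∀ A K → K * (A * A * K - + 4 * A) ≡ (A * K - + 2) * (A * K - + 2) - + 4
ab≡r²-4 = solve-∀

ac≡s²-4 : ∀ A K →
  K * ((A + 1ℤ) * (A + 1ℤ) * K - + 4 * (A + 1ℤ)) ≡ ((A + 1ℤ) * K - + 2) * ((A + 1ℤ) * K - + 2) - + 4
ac≡s²-4 = solve-∀

s-r≡K : ∀ A K → (A + 1ℤ) * K - + 2 - (A * K - + 2) ≡ K
s-r≡K = solve-∀

lemma3p5 : (A K : ℤ) → Hyp A K → AlphaMinusBetaGtK A K
lemma3p5 A K hyp =
  let 2≤r , r<s = Hyp⇒2≤r<s hyp
      p , q , p-above , q-below , gap = √[x²-4]-gap 2≤r r<s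
  in p , q ,
     subst (λ n → SqrtLt n p) (sym (ab≡r²-4 A K)) p-above ,
     subst (LtSqrt q) (sym (ac≡s²-4 A K)) q-below ,
     subst (λ k → ι k ℚ.< ((ι (s A K) ℚ.+ q) ℚ.* ½) ℚ.- ((ι (r A K) ℚ.+ p) ℚ.* ½))
       (s-r≡K A K) gap
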